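{- Let $A$ be the adjacency matrix of a regular tournament, and let $$B=\begin{bmatrix} A & A^T\\ A & A^T\end{bmatrix},\qquad C=\begin{bmatrix} A & A\\ A^T & A^T\end{bmatrix}.$$ If there exists a permutation matrix $P$ such that $PA=A^T=AP$, then $B\cong C$, i.e. there is a permutation matrix $Q$ with $QBQ^{ -1}=C$ (so the directed graphs with adjacency matrices $B$ and $C$ are isomorphic).
   Context: A tournament is a directed graph without loops in which for every pair of distinct vertices $x,y$ exactly one of the arcs $x\to y$, $y\to x$ is present; its $0/1$ adjacency matrix $A$ satisfies $A+A^T=J-I$. It is regular if all out-degrees are equal. -}

module Defs where

open import Data.Nat using (ℕ; zero; suc; _+_; _*_)
open import Data.Fin using (Fin; zero; suc; splitAt)
open import Data.Sum using (_⊎_; inj₁; inj₂)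
open import Data.Product using (∃; _×_)
open import Relation.Binary.PropositionalEquality using (_≡_; _≢_)

Mat : ℕ → Set
Mat n = Fin n → Fin n → ℕ

∑ : (n : ℕ) → (Fin n → ℕ) → ℕ
∑ zero    f = 0
∑ (suc n) f = f zero + ∑ n (λ i → f (suc i))

_·_ : {n : ℕ} → Mat n → Mat n → Mat n
_·_ {n} M N i j = ∑ n (λ k → M i k * N k j)

transpose : {n : ℕ} → Mat n → Mat n
transpose M i j = M j i

IsBit : ℕ → Set
IsBit x = (x ≡ 0) ⊎ (x ≡ 1)

IsTournament : {n : ℕ} → Mat n → Set
IsTournament {n} A =
  (∀ i j → IsBit (A i j)) ×
  (∀ i → A i i ≡ 0) ×
  (∀ i j → i ≢ j → A i j + A j i ≡ 1)

outdeg : {n : ℕ} → Mat n → Fin n → ℕ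
outdeg {n} A i = ∑ n (λ j → A i j)

IsRegular : {n : ℕ} → Mat n → Set
IsRegular {n} A = ∃ λ k → ∀ i → outdeg A i ≡ k

-- pointwise matrix equality (no function extensionality in Agda)
infix 4 _≐_
_≐_ : {n : ℕ} → Mat n → Mat n → Set
M ≐ N = ∀ i j → M i j ≡ N i j

IsPermutationMatrix : {n : ℕ} → Mat n → Set
IsPermutationMatrix {n} P =
  (∀ i j → IsBit (P i j)) ×
  (∀ i → ∑ n (λ j → P i j) ≡ 1) ×
  (∀ j → ∑ n (λ i → P i j) ≡ 1)

block : {n : ℕ} → Mat n → Mat n → Mat n → Mat n → Mat (n + n)
block {n} X Y Z W i j with splitAt n i | splitAt n j
... | inj₁ a | inj₁ b = X a b
... | inj₁ a | inj₂ b = Y a b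
... | inj₂ a | inj₁ b = Z a b
... | inj₂ a | inj₂ b = W a b

-- Take Q = diag(I, P). Conjugation by a block-diagonal matrix acts on each block
-- separately, so Q B Qᵀ has blocks I A I = A, I Aᵀ Pᵀ = (P A)ᵀ = A, P A I = Aᵀ and
-- P Aᵀ Pᵀ = P (P A)ᵀ = P A = Aᵀ, which are exactly the blocks of C.

module Submission where

open import Defs
open import Data.Nat using (ℕ; zero; suc; _+_; _*_)
open import Data.Nat.Properties using (+-*-semiring; +-assoc; +-identityʳ; *-identityˡ; *-identityʳ; *-zeroʳ; *-comm; *-assoc)
open import Data.Fin using (Fin; zero; suc; splitAt; _↑ˡ_; _↑ʳ_)
open import Data.Fin.Properties using (splitAt-↑ˡ; splitAt-↑ʳ; splitAt⁻¹-↑ˡ; splitAt⁻¹-↑ʳ)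
open import Data.Sum using (inj₁; inj₂)
open import Data.Product using (∃; ∃₂; _×_; _,_; proj₁; proj₂)
open import Function using (_∘_)
open import Relation.Binary.PropositionalEquality
open import Algebra.Properties.Semiring.Sum +-*-semiring
  using (sum; sum-cong-≗; sum-replicate-zero; *-distribˡ-sum; *-distribʳ-sum)
  renaming (∑-comm to sum-comm)

open ≡-Reasoning

∑≡sum : ∀ n (f : Fin n → ℕ) → ∑ n f ≡ sum f
∑≡sum zero    f = refl
∑≡sum (suc n) f = cong (f zero +_) (∑≡sum n (f ∘ suc))

∑-cong : ∀ n {f g : Fin n → ℕ} → (∀ k → f k ≡ g k) → ∑ n f ≡ ∑ n g
∑-cong n {f} {g} f≗g = begin
  ∑ n f  ≡⟨ ∑≡sum n f ⟩
  sum f  ≡⟨ sum-cong-≗ f≗g ⟩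
  sum g  ≡⟨ ∑≡sum n g ⟨
  ∑ n g  ∎

∑-zero : ∀ n → ∑ n (λ _ → 0) ≡ 0
∑-zero n = trans (∑≡sum n _) (sum-replicate-zero n)

*-distribˡ-∑ : ∀ n c (f : Fin n → ℕ) → c * ∑ n f ≡ ∑ n (λ k → c * f k)
*-distribˡ-∑ n c f = begin
  c * ∑ n f                ≡⟨ cong (c *_) (∑≡sum n f) ⟩
  c * sum f                ≡⟨ *-distribˡ-sum c f ⟩
  sum (λ k → c * f k)      ≡⟨ ∑≡sum n _ ⟨
  ∑ n (λ k → c * f k)      ∎

*-distribʳ-∑ : ∀ n c (f : Fin n → ℕ) → ∑ n f * c ≡ ∑ n (λ k → f k * c)
*-distribʳ-∑ n c f = begin
  ∑ n f * c                ≡⟨ cong (_* c) (∑≡sum n f) ⟩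
  sum f * c                ≡⟨ *-distribʳ-sum c f ⟩
  sum (λ k → f k * c)      ≡⟨ ∑≡sum n _ ⟨
  ∑ n (λ k → f k * c)      ∎

∑-comm : ∀ m n (f : Fin m → Fin n → ℕ) →
         ∑ m (λ i → ∑ n (f i)) ≡ ∑ n (λ j → ∑ m (λ i → f i j))
∑-comm m n f = begin
  ∑ m (λ i → ∑ n (f i))              ≡⟨ ∑-cong m (λ i → ∑≡sum n (f i)) ⟩
  ∑ m (λ i → sum (f i))              ≡⟨ ∑≡sum m _ ⟩
  sum (λ i → sum (f i))              ≡⟨ sum-comm f ⟩
  sum (λ j → sum (λ i → f i j))      ≡⟨ ∑≡sum n _ ⟨
  ∑ n (λ j → sum (λ i → f i j))      ≡⟨ ∑-cong n (λ j → ∑≡sum m (λ i → f i j)) ⟨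
  ∑ n (λ j → ∑ m (λ i → f i j))      ∎

∑-splitAt : ∀ m n (f : Fin (m + n) → ℕ) →
            ∑ (m + n) f ≡ ∑ m (λ k → f (k ↑ˡ n)) + ∑ n (λ k → f (m ↑ʳ k))
∑-splitAt zero    n f = refl
∑-splitAt (suc m) n f =
  trans (cong (f zero +_) (∑-splitAt m n (f ∘ suc))) (sym (+-assoc (f zero) _ _))

·-congˡ : ∀ {n} {M M′ : Mat n} (N : Mat n) → M ≐ M′ → M · N ≐ M′ · N
·-congˡ {n} N M≐M′ i j = ∑-cong n (λ k → cong (_* N k j) (M≐M′ i k))

·-congʳ : ∀ {n} (M : Mat n) {N N′ : Mat n} → N ≐ N′ → M · N ≐ M · N′
·-congʳ {n} M N≐N′ i j = ∑-cong n (λ k → cong (M i k *_) (N≐N′ k j))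

·-assoc : ∀ {n} (M N K : Mat n) → (M · N) · K ≐ M · (N · K)
·-assoc {n} M N K i j = begin
  ∑ n (λ l → ∑ n (λ k → M i k * N k l) * K l j)      ≡⟨ ∑-cong n (λ l → *-distribʳ-∑ n (K l j) _) ⟩
  ∑ n (λ l → ∑ n (λ k → M i k * N k l * K l j))      ≡⟨ ∑-comm n n _ ⟩
  ∑ n (λ k → ∑ n (λ l → M i k * N k l * K l j))      ≡⟨ ∑-cong n (λ k → ∑-cong n (λ l → *-assoc (M i k) _ _)) ⟩
  ∑ n (λ k → ∑ n (λ l → M i k * (N k l * K l j)))    ≡⟨ ∑-cong n (λ k → *-distribˡ-∑ n (M i k) _) ⟨
  ∑ n (λ k → M i k * ∑ n (λ l → N k l * K l j))      ∎

transpose-· : ∀ {n} (M N : Mat n) → transpose (M · N) ≐ transpose N · transpose M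
transpose-· {n} M N i j = ∑-cong n (λ k → *-comm (M j k) (N k i))

I : ∀ {n} → Mat n
I zero    zero    = 1
I zero    (suc _) = 0
I (suc _) zero    = 0
I (suc i) (suc j) = I i j

I-symmetric : ∀ {n} → transpose (I {n}) ≐ I
I-symmetric zero    zero    = refl
I-symmetric zero    (suc _) = refl
I-symmetric (suc _) zero    = refl
I-symmetric (suc i) (suc j) = I-symmetric i j

∑-I-* : ∀ n (i : Fin n) (f : Fin n → ℕ) → ∑ n (λ k → I i k * f k) ≡ f i
∑-I-* (suc n) zero    f = trans (cong (f zero + 0 +_) (∑-zero n)) (trans (+-identityʳ _) (+-identityʳ _))
∑-I-* (suc n) (suc i) f = ∑-I-* n i (f ∘ suc)

·-identityˡ : ∀ {n} (M : Mat n) → I · M ≐ M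
·-identityˡ {n} M i j = ∑-I-* n i (λ k → M k j)

·-transpose-identityʳ : ∀ {n} (M : Mat n) → M · transpose I ≐ M
·-transpose-identityʳ {n} M i j =
  trans (∑-cong n (λ k → *-comm (M i k) (I j k))) (∑-I-* n j (M i))

I-isPermutationMatrix : ∀ n → IsPermutationMatrix (I {n})
I-isPermutationMatrix n = I-isBit , row-sum , λ j → trans (∑-cong n (λ k → I-symmetric j k)) (row-sum j)
  where
  I-isBit : ∀ {n} (i j : Fin n) → IsBit (I i j)
  I-isBit zero    zero    = inj₂ refl
  I-isBit zero    (suc _) = inj₁ refl
  I-isBit (suc _) zero    = inj₁ refl
  I-isBit (suc i) (suc j) = I-isBit i j

  row-sum : ∀ i → ∑ n (I i) ≡ 1
  row-sum i = trans (∑-cong n (λ k → sym (*-identityʳ (I i k)))) (∑-I-* n i (λ _ → 1))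

transpose-·-transpose : ∀ {n} (P A : Mat n) → P · A ≐ transpose A → transpose A · transpose P ≐ A
transpose-·-transpose P A PA≐Aᵀ i j = trans (sym (transpose-· P A i j)) (PA≐Aᵀ j i)

conjugate-transpose : ∀ {n} (P A : Mat n) → P · A ≐ transpose A →
                      (P · transpose A) · transpose P ≐ transpose A
conjugate-transpose P A PA≐Aᵀ i j = begin
  ((P · transpose A) · transpose P) i j   ≡⟨ ·-assoc P (transpose A) (transpose P) i j ⟩
  (P · (transpose A · transpose P)) i j   ≡⟨ ·-congʳ P (transpose-·-transpose P A PA≐Aᵀ) i j ⟩
  (P · A) i j                             ≡⟨ PA≐Aᵀ i j ⟩
  A j i                                   ∎

data Half : Set where
  first second : Half

embed : ∀ {n} → Half → Fin n → Fin (n + n)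
embed {n} first  i = i ↑ˡ n
embed {n} second i = n ↑ʳ i

embed-surjective : ∀ {n} (r : Fin (n + n)) → ∃₂ λ h i → embed {n} h i ≡ r
embed-surjective {n} r with splitAt n r in eq
... | inj₁ i = first  , i , splitAt⁻¹-↑ˡ eq
... | inj₂ i = second , i , splitAt⁻¹-↑ʳ eq

quadrant : ∀ {n} → Mat n → Mat n → Mat n → Mat n → Half → Half → Mat n
quadrant X Y Z W first  first  = X
quadrant X Y Z W first  second = Y
quadrant X Y Z W second first  = Z
quadrant X Y Z W second second = W

block-embed : ∀ {n} (X Y Z W : Mat n) h h′ i j →
              block X Y Z W (embed h i) (embed h′ j) ≡ quadrant X Y Z W h h′ i j
block-embed {n} X Y Z W first  first  i j rewrite splitAt-↑ˡ n i n | splitAt-↑ˡ n j n = refl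
block-embed {n} X Y Z W first  second i j rewrite splitAt-↑ˡ n i n | splitAt-↑ʳ n n j = refl
block-embed {n} X Y Z W second first  i j rewrite splitAt-↑ʳ n n i | splitAt-↑ˡ n j n = refl
block-embed {n} X Y Z W second second i j rewrite splitAt-↑ʳ n n i | splitAt-↑ʳ n n j = refl

block-row-∑ : ∀ {n} (X Y Z W : Mat n) h i (f : Fin (n + n) → ℕ) →
  ∑ (n + n) (λ k → block X Y Z W (embed h i) k * f k)
  ≡ ∑ n (λ k → quadrant X Y Z W h first i k * f (embed first k))
    + ∑ n (λ k → quadrant X Y Z W h second i k * f (embed second k))
block-row-∑ {n} X Y Z W h i f = trans (∑-splitAt n n _) (cong₂ _+_
  (∑-cong n (λ k → cong (_* f (embed first k)) (block-embed X Y Z W h first i k)))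
  (∑-cong n (λ k → cong (_* f (embed second k)) (block-embed X Y Z W h second i k))))

block-column-∑ : ∀ {n} (X Y Z W : Mat n) h j (f : Fin (n + n) → ℕ) →
  ∑ (n + n) (λ k → f k * block X Y Z W k (embed h j))
  ≡ ∑ n (λ k → f (embed first k) * quadrant X Y Z W first h k j)
    + ∑ n (λ k → f (embed second k) * quadrant X Y Z W second h k j)
block-column-∑ {n} X Y Z W h j f = trans (∑-splitAt n n _) (cong₂ _+_
  (∑-cong n (λ k → cong (f (embed first k) *_) (block-embed X Y Z W first h k j)))
  (∑-cong n (λ k → cong (f (embed second k) *_) (block-embed X Y Z W second h k j))))

O : ∀ {n} → Mat n
O _ _ = 0

blockDiag : ∀ {n} → Mat n → Mat n → Mat (n + n)
blockDiag D E = block D O O E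

diagonalBlock : ∀ {n} → Mat n → Mat n → Half → Mat n
diagonalBlock D E first  = D
diagonalBlock D E second = E

blockDiag-row-∑ : ∀ {n} (D E : Mat n) h i (f : Fin (n + n) → ℕ) →
  ∑ (n + n) (λ k → blockDiag D E (embed h i) k * f k)
  ≡ ∑ n (λ k → diagonalBlock D E h i k * f (embed h k))
blockDiag-row-∑ {n} D E first i f =
  trans (block-row-∑ D O O E first i f) (trans (cong (row +_) (∑-zero n)) (+-identityʳ row))
  where row = ∑ n (λ k → D i k * f (embed first k))
blockDiag-row-∑ {n} D E second i f =
  trans (block-row-∑ D O O E second i f) (cong (_+ row) (∑-zero n))
  where row = ∑ n (λ k → E i k * f (embed second k))

blockDiag-column-∑ : ∀ {n} (D E : Mat n) h j (f : Fin (n + n) → ℕ) →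
  ∑ (n + n) (λ k → f k * blockDiag D E k (embed h j))
  ≡ ∑ n (λ k → f (embed h k) * diagonalBlock D E h k j)
blockDiag-column-∑ {n} D E first j f =
  trans (block-column-∑ D O O E first j f)
        (trans (cong (column +_) (vanishing second)) (+-identityʳ column))
  where
  column = ∑ n (λ k → f (embed first k) * D k j)
  vanishing : ∀ h → ∑ n (λ k → f (embed h k) * 0) ≡ 0
  vanishing h = trans (∑-cong n (λ k → *-zeroʳ (f (embed h k)))) (∑-zero n)
blockDiag-column-∑ {n} D E second j f =
  trans (block-column-∑ D O O E second j f) (cong (_+ column) (vanishing first))
  where
  column = ∑ n (λ k → f (embed second k) * E k j)
  vanishing : ∀ h → ∑ n (λ k → f (embed h k) * 0) ≡ 0
  vanishing h = trans (∑-cong n (λ k → *-zeroʳ (f (embed h k)))) (∑-zero n)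

blockDiag-isPermutationMatrix : ∀ {n} {D E : Mat n} →
  IsPermutationMatrix D → IsPermutationMatrix E → IsPermutationMatrix (blockDiag D E)
blockDiag-isPermutationMatrix {n} {D} {E} D-perm E-perm = isBit , row-sum , column-sum
  where
  diagonalBlock-isPermutationMatrix : ∀ h → IsPermutationMatrix (diagonalBlock D E h)
  diagonalBlock-isPermutationMatrix first  = D-perm
  diagonalBlock-isPermutationMatrix second = E-perm

  quadrant-isBit : ∀ h h′ i j → IsBit (quadrant D O O E h h′ i j)
  quadrant-isBit first  first  = proj₁ D-perm
  quadrant-isBit first  second = λ _ _ → inj₁ refl
  quadrant-isBit second first  = λ _ _ → inj₁ refl
  quadrant-isBit second second = proj₁ E-perm

  isBit : ∀ r c → IsBit (blockDiag D E r c)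
  isBit r c with embed-surjective {n} r | embed-surjective {n} c
  ... | h , i , refl | h′ , j , refl =
    subst IsBit (sym (block-embed D O O E h h′ i j)) (quadrant-isBit h h′ i j)

  row-sum : ∀ r → ∑ (n + n) (blockDiag D E r) ≡ 1
  row-sum r with embed-surjective {n} r
  ... | h , i , refl = begin
    ∑ (n + n) (λ k → blockDiag D E (embed h i) k)       ≡⟨ ∑-cong (n + n) (λ k → *-identityʳ _) ⟨
    ∑ (n + n) (λ k → blockDiag D E (embed h i) k * 1)   ≡⟨ blockDiag-row-∑ D E h i (λ _ → 1) ⟩
    ∑ n (λ k → diagonalBlock D E h i k * 1)             ≡⟨ ∑-cong n (λ k → *-identityʳ _) ⟩
    ∑ n (diagonalBlock D E h i)                         ≡⟨ proj₁ (proj₂ (diagonalBlock-isPermutationMatrix h)) i ⟩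
    1                                                   ∎

  column-sum : ∀ c → ∑ (n + n) (λ r → blockDiag D E r c) ≡ 1
  column-sum c with embed-surjective {n} c
  ... | h , j , refl = begin
    ∑ (n + n) (λ k → blockDiag D E k (embed h j))       ≡⟨ ∑-cong (n + n) (λ k → *-identityˡ _) ⟨
    ∑ (n + n) (λ k → 1 * blockDiag D E k (embed h j))   ≡⟨ blockDiag-column-∑ D E h j (λ _ → 1) ⟩
    ∑ n (λ k → 1 * diagonalBlock D E h k j)             ≡⟨ ∑-cong n (λ k → *-identityˡ _) ⟩
    ∑ n (λ k → diagonalBlock D E h k j)                 ≡⟨ proj₂ (proj₂ (diagonalBlock-isPermutationMatrix h)) j ⟩
    1                                                   ∎

blockDiag-·-block : ∀ {n} (D E X Y Z W : Mat n) h h′ i j →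
  (blockDiag D E · block X Y Z W) (embed h i) (embed h′ j)
  ≡ (diagonalBlock D E h · quadrant X Y Z W h h′) i j
blockDiag-·-block {n} D E X Y Z W h h′ i j =
  trans (blockDiag-row-∑ D E h i (λ k → block X Y Z W k (embed h′ j)))
        (∑-cong n (λ k → cong (diagonalBlock D E h i k *_) (block-embed X Y Z W h h′ k j)))

blockDiag-conjugate-block : ∀ {n} (D E X Y Z W : Mat n) h h′ i j →
  ((blockDiag D E · block X Y Z W) · transpose (blockDiag D E)) (embed h i) (embed h′ j)
  ≡ ((diagonalBlock D E h · quadrant X Y Z W h h′) · transpose (diagonalBlock D E h′)) i j
blockDiag-conjugate-block {n} D E X Y Z W h h′ i j = begin
  ∑ (n + n) (λ k → DM (embed h i) k * blockDiag D E (embed h′ j) k)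
    ≡⟨ ∑-cong (n + n) (λ k → *-comm (DM (embed h i) k) _) ⟩
  ∑ (n + n) (λ k → blockDiag D E (embed h′ j) k * DM (embed h i) k)
    ≡⟨ blockDiag-row-∑ D E h′ j (DM (embed h i)) ⟩
  ∑ n (λ k → diagonalBlock D E h′ j k * DM (embed h i) (embed h′ k))
    ≡⟨ ∑-cong n (λ k → trans (*-comm (diagonalBlock D E h′ j k) _)
                                  (cong (_* diagonalBlock D E h′ j k) (blockDiag-·-block D E X Y Z W h h′ i k))) ⟩
  ∑ n (λ k → (diagonalBlock D E h · quadrant X Y Z W h h′) i k * diagonalBlock D E h′ j k)
    ∎
  where DM = blockDiag D E · block X Y Z W

lemma12 : (n : ℕ) (A : Mat n) →
    IsTournament A → IsRegular A →
    (∃ λ P → IsPermutationMatrix P × (P · A ≐ transpose A) × (A · P ≐ transpose A)) →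
    ∃ λ (Q : Mat (n + n)) → IsPermutationMatrix Q ×
      ((Q · block A (transpose A) A (transpose A)) · transpose Q
        ≐ block A A (transpose A) (transpose A))
lemma12 n A _ _ (P , P-perm , PA≐Aᵀ , _) =
  blockDiag I P , blockDiag-isPermutationMatrix (I-isPermutationMatrix n) P-perm , conjugate
  where
  Aᵀ = transpose A

  quadrants : ∀ h h′ → (diagonalBlock I P h · quadrant A Aᵀ A Aᵀ h h′) · transpose (diagonalBlock I P h′)
                       ≐ quadrant A A Aᵀ Aᵀ h h′
  quadrants first  first  i j = trans (·-transpose-identityʳ (I · A) i j) (·-identityˡ A i j)
  quadrants first  second i j = trans (·-congˡ (transpose P) (·-identityˡ Aᵀ) i j)
                                      (transpose-·-transpose P A PA≐Aᵀ i j)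
  quadrants second first  i j = trans (·-transpose-identityʳ (P · A) i j) (PA≐Aᵀ i j)
  quadrants second second     = conjugate-transpose P A PA≐Aᵀ

  conjugate : (blockDiag I P · block A Aᵀ A Aᵀ) · transpose (blockDiag I P) ≐ block A A Aᵀ Aᵀ
  conjugate r c with embed-surjective {n} r | embed-surjective {n} c
  ... | h , i , refl | h′ , j , refl = begin
    ((blockDiag I P · block A Aᵀ A Aᵀ) · transpose (blockDiag I P)) (embed h i) (embed h′ j)
      ≡⟨ blockDiag-conjugate-block I P A Aᵀ A Aᵀ h h′ i j ⟩
    ((diagonalBlock I P h · quadrant A Aᵀ A Aᵀ h h′) · transpose (diagonalBlock I P h′)) i j
      ≡⟨ quadrants h h′ i j ⟩
    quadrant A A Aᵀ Aᵀ h h′ i j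
      ≡⟨ block-embed A A Aᵀ Aᵀ h h′ i j ⟨
    block A A Aᵀ Aᵀ (embed h i) (embed h′ j)
      ∎
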